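{- Let $d$ and $k$ be positive integers with $k \geq d+1$, and let $\epsilon > 0$. Then there exist a constant $c = c(d,\epsilon)$ and a constant $C > 0$, neither depending on the graph or on $n$, such that for every graph $G$ with $n$ vertices whose maximum average degree equals $d - \epsilon$, the reconfiguration graph $R_k(G)$ has diameter at most $C n^{c}$ (i.e. the diameter of $R_k(G)$ is $O(n^c)$; in particular every two $k$-colourings of $G$ are joined by a path in $R_k(G)$ of length at most $C n^c$).
   Context: All graphs are finite and simple. For a non-negative integer $k$, a $k$-colouring of a graph $G$ is a function $f: V(G) \to \{1,\dots,k\}$ with $f(u) \neq f(v)$ whenever $uv \in E(G)$. The reconfiguration graph $R_k(G)$ has as vertex set the set of all $k$-colourings of $G$, two colourings being adjacent if and only if they differ on exactly one vertex of $G$. The diameter of a graph is the maximum distance between two of its vertices (infinite if the graph is disconnected). The maximum average degree of $G$ is $\max\{ 2|E(H)|/|V(H)| : H \subseteq G\}$, the maximum over all subgraphs $H$ of $G$ with at least one vertex. -}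

module Defs where

open import Data.Bool using (Bool; true; false; T; if_then_else_)
open import Data.Nat as ℕ using (ℕ; zero; suc; _<ᵇ_; NonZero; >-nonZero)
open import Data.Fin using (Fin; toℕ)
open import Data.List using (List; map; allFin)
open import Data.Nat.ListAction using (sum)
open import Data.Integer using (+_)
open import Data.Rational using (ℚ; _/_; _≤_)
open import Data.Product using (_×_; Σ; Σ-syntax)
open import Relation.Binary.PropositionalEquality using (_≡_; _≢_)

record Graph (n : ℕ) : Set where
  field
    adj     : Fin n → Fin n → Bool
    adj-sym : ∀ u v → adj u v ≡ adj v u
    adj-irr : ∀ v → adj v v ≡ false
open Graph public

count : ∀ {n} → (Fin n → Bool) → ℕ
count {n} p = sum (map (λ i → if p i then 1 else 0) (allFin n))

record Subgraph {n : ℕ} (G : Graph n) : Set where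
  field
    verts     : Fin n → Bool
    edges     : Fin n → Fin n → Bool
    edges-sym : ∀ u v → edges u v ≡ edges v u
    edges-⊆   : ∀ u v → T (edges u v) → T (adj G u v) × T (verts u) × T (verts v)
open Subgraph public

|V| : ∀ {n} {G : Graph n} → Subgraph G → ℕ
|V| H = count (verts H)

-- edges counted once, as unordered pairs {u,v} with u < v
|E| : ∀ {n} {G : Graph n} → Subgraph G → ℕ
|E| {n} H = sum (map (λ u → count (λ v → if toℕ u <ᵇ toℕ v then edges H u v else false)) (allFin n))

avgDeg : ∀ {n} {G : Graph n} (H : Subgraph G) → ℕ._<_ 0 (|V| H) → ℚ
avgDeg H p = (+ (2 ℕ.* |E| H) / |V| H) {{>-nonZero p}}

MadEq : ∀ {n} → Graph n → ℚ → Set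
MadEq G q =
  (∀ (H : Subgraph G) (p : ℕ._<_ 0 (|V| H)) → avgDeg H p ≤ q)
  × (Σ[ H ∈ Subgraph G ] Σ[ p ∈ ℕ._<_ 0 (|V| H) ] avgDeg H p ≡ q)

Proper : ∀ {n} (G : Graph n) (k : ℕ) → (Fin n → Fin k) → Set
Proper G k f = ∀ u v → T (adj G u v) → f u ≢ f v

-- adjacency in R_k(G): differ on exactly one vertex
DifferOnOne : ∀ {n k} → (Fin n → Fin k) → (Fin n → Fin k) → Set
DifferOnOne {n} f g = Σ[ v ∈ Fin n ] (f v ≢ g v × (∀ u → u ≢ v → f u ≡ g u))

-- Reach G k L f g : there is a path in R_k(G) from f to g of length at most L
-- (colourings are compared pointwise)
data Reach {n} (G : Graph n) (k : ℕ) : ℕ → (Fin n → Fin k) → (Fin n → Fin k) → Set where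
  here : ∀ {L f g} → (∀ v → f v ≡ g v) → Reach G k L f g
  step : ∀ {L f h g} → Proper G k h → DifferOnOne f h → Reach G k L h g → Reach G k (suc L) f g

-- Write ε = (p + 1)/(q + 1) and N = (q + 1)d. As every subgraph has average degree at most
-- d − ε, the handshake lemma shows that every vertex set S contains at least |S|/N low
-- vertices: those with fewer than d neighbours in S. A proper colouring f is turned into g
-- on S recursively. First recolour the rest S ∖ low(S), ignoring the low vertices. Then
-- make those moves legal in G[S]: before a move (v, c), push every low neighbour of v
-- coloured c to a colour different from c and absent from its fewer than d neighbours in
-- S, which exists as k ≥ d + 1. Finally give every low vertex its g-colour, pushing in the
-- same way. If no vertex moves more than M times on the rest, a low vertex moves at most
-- (deg + 1)(M + 1) ≤ d(M + 1) times; since the rest has at most (1 − 1/N)|S| vertices,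
-- Bernoulli's inequality bounds the moves of each vertex by d|S|^(N(d + 1)). Summing over
-- the n vertices gives a path of length at most d n^(N(d + 1) + 1).

module Submission where

module Reconfiguration where

  open import Data.Nat.Properties hiding (_≟_)
  open import Algebra.Properties.CommutativeSemigroup *-commutativeSemigroup using (x∙yz≈y∙xz)
  open import Algebra.Properties.Semiring.Sum +-*-semiring
    using (sum-syntax; ∑-comm; ∑-distrib-+; *-distribˡ-sum; *-distribʳ-sum; sum-cong-≗; sum-replicate-zero)
  open import Data.Bool using (Bool; true; false; T; if_then_else_; _∧_; _∨_; not)
  open import Data.Bool.ListAction using (any)
  open import Data.Bool.Properties using (T?; T-∧; T-∨; ∧-zeroʳ)
  open import Data.Empty using (⊥-elim)
  open import Data.Fin using (Fin; zero; suc; toℕ; _≟_)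
  open import Data.Fin.Properties using (¬∀⟶∃¬; toℕ-injective)
  import Data.Integer as ℤ
  import Data.Integer.Properties as ℤP
  open import Data.List using (List; []; _∷_; _++_; map; allFin; tabulate; length; foldl)
  open import Data.List.Membership.Propositional using (_∈_)
  open import Data.List.Membership.Propositional.Properties using (∈-allFin)
  open import Data.List.Properties using (map-tabulate; foldl-++)
  open import Data.List.Relation.Unary.Any as Any using (here; there)
  open import Data.List.Relation.Unary.Any.Properties using (any⁺)
  open import Data.Nat using (ℕ; zero; suc; _+_; _*_; _^_; _≤_; _<_; z≤n; s≤s; z<s; _<ᵇ_; NonZero; >-nonZero; >-nonZero⁻¹)
  open import Data.Nat.Coprimality using (Coprime)
  import Data.Nat.ListAction as ListAction
  open import Data.Nat.Solver using (module +-*-Solver)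
  open import Data.Product using (_×_; _,_; proj₁; proj₂; ∃; Σ-syntax)
  open import Data.Rational as ℚ using (mkℚ; _/_)
  import Data.Rational.Properties as ℚP
  open import Data.Rational.Unnormalised as ℚᵘ using (mkℚᵘ)
  import Data.Rational.Unnormalised.Properties as ℚᵘP
  open import Data.Sum using (_⊎_; inj₁; inj₂)
  open import Data.Unit using (⊤; tt)
  open import Data.Vec.Functional using (updateAt)
  open import Data.Vec.Functional.Properties using (updateAt-updates; updateAt-minimal)
  open import Function using (_∘_; id; const)
  open import Function.Bundles using (Equivalence)
  open import Relation.Binary.PropositionalEquality
  open import Relation.Nullary using (¬_; yes; no; contradiction; _×-dec_)
  open import Relation.Nullary.Decidable using (Dec; does)

  open import Defs

  ⟦_⟧ : Bool → ℕ
  ⟦ b ⟧ = if b then 1 else 0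

  T⇒⟦⟧≡1 : ∀ {b} → T b → ⟦ b ⟧ ≡ 1
  T⇒⟦⟧≡1 {true} _ = refl

  ⟦∧⟧ : ∀ a b → ⟦ a ∧ b ⟧ ≡ ⟦ a ⟧ * ⟦ b ⟧
  ⟦∧⟧ true  b = sym (+-identityʳ ⟦ b ⟧)
  ⟦∧⟧ false b = refl

  T-does : ∀ {A : Set} (a? : Dec A) → A → T (does a?)
  T-does (yes _) _ = tt
  T-does (no ¬a) a = ¬a a

  ⟦T∧⟧ : ∀ {a} b → T a → ⟦ a ∧ b ⟧ ≡ ⟦ b ⟧
  ⟦T∧⟧ {true} b _ = refl

  ⟦⟧≤1 : ∀ b → ⟦ b ⟧ ≤ 1
  ⟦⟧≤1 true  = ≤-refl
  ⟦⟧≤1 false = z≤n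

  ⟦∨⟧ : ∀ a b → ⟦ a ∨ b ⟧ ≤ ⟦ a ⟧ + ⟦ b ⟧
  ⟦∨⟧ true  b = s≤s z≤n
  ⟦∨⟧ false b = ≤-refl

  sum-tabulate : ∀ {n} (f : Fin n → ℕ) → ListAction.sum (tabulate f) ≡ ∑[ i < n ] f i
  sum-tabulate {zero}  f = refl
  sum-tabulate {suc n} f = cong (f zero +_) (sum-tabulate (f ∘ suc))

  sum-allFin : ∀ {n} (f : Fin n → ℕ) → ListAction.sum (map f (allFin n)) ≡ ∑[ i < n ] f i
  sum-allFin f = trans (cong ListAction.sum (map-tabulate id f)) (sum-tabulate f)

  count≡∑ : ∀ {n} (p : Fin n → Bool) → count p ≡ ∑[ i < n ] ⟦ p i ⟧
  count≡∑ p = sum-allFin (λ i → ⟦ p i ⟧)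

  ∑-mono-≤ : ∀ {n} {f g : Fin n → ℕ} → (∀ i → f i ≤ g i) → ∑[ i < n ] f i ≤ ∑[ i < n ] g i
  ∑-mono-≤ {zero}  f≤g = z≤n
  ∑-mono-≤ {suc n} f≤g = +-mono-≤ (f≤g zero) (∑-mono-≤ (f≤g ∘ suc))

  term≤∑ : ∀ {n} (f : Fin n → ℕ) i → f i ≤ ∑[ j < n ] f j
  term≤∑ f zero    = m≤m+n _ _
  term≤∑ f (suc i) = ≤-trans (term≤∑ (f ∘ suc) i) (m≤n+m _ _)

  ∑-δ : ∀ {n} (v : Fin n) (w : Fin n → ℕ) → ∑[ i < n ] (⟦ does (v ≟ i) ⟧ * w i) ≡ w v
  ∑-δ {suc n} zero    w = trans (cong (w zero + 0 +_) (sum-replicate-zero n)) (trans (+-identityʳ _) (+-identityʳ _))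
  ∑-δ {suc n} (suc v) w = ∑-δ v (λ i → w (suc i))

  ≟-sym : ∀ {n} (i j : Fin n) → does (i ≟ j) ≡ does (j ≟ i)
  ≟-sym i j with i ≟ j | j ≟ i
  ... | yes refl | yes _    = refl
  ... | yes refl | no j≢i   = contradiction refl j≢i
  ... | no i≢j   | yes refl = contradiction refl i≢j
  ... | no _     | no _     = refl

  sum-δ-allFin : ∀ {n} (x : Fin n) (w : Fin n → ℕ) →
               ListAction.sum (map (λ u → ⟦ does (u ≟ x) ⟧ * w u) (allFin n)) ≡ w x
  sum-δ-allFin x w = trans (sum-allFin (λ u → ⟦ does (u ≟ x) ⟧ * w u))
                         (trans (sum-cong-≗ (λ u → cong (λ b → ⟦ b ⟧ * w u) (≟-sym u x))) (∑-δ x w))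

  ∑-ones : ∀ {n} → ∑[ i < n ] 1 ≡ n
  ∑-ones {zero}  = refl
  ∑-ones {suc n} = cong suc ∑-ones

  count-all : ∀ {n} (p : Fin n → Bool) → (∀ i → T (p i)) → count p ≡ n
  count-all p all = trans (count≡∑ p) (trans (sum-cong-≗ (λ i → T⇒⟦⟧≡1 (all i))) ∑-ones)

  count<⇒∃¬ : ∀ {n} (p : Fin n → Bool) → count p < n → ∃ λ i → ¬ T (p i)
  count<⇒∃¬ {n} p lt = ¬∀⟶∃¬ n (T ∘ p) (T? ∘ p) (λ all → <-irrefl (count-all p all) lt)

  count≡0⇒¬ : ∀ {n} (p : Fin n → Bool) → count p ≡ 0 → ∀ i → ¬ T (p i)
  count≡0⇒¬ p c≡0 i pi = 1≰0 (subst₂ _≤_ (T⇒⟦⟧≡1 pi) (trans (sym (count≡∑ p)) c≡0) (term≤∑ _ i))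
    where
    1≰0 : ¬ 1 ≤ 0
    1≰0 ()

  ⟦any⟧≤sum : ∀ {A : Set} (q : A → Bool) xs → ⟦ any q xs ⟧ ≤ ListAction.sum (map (λ x → ⟦ q x ⟧) xs)
  ⟦any⟧≤sum q []       = z≤n
  ⟦any⟧≤sum q (x ∷ xs) = ≤-trans (⟦∨⟧ (q x) (any q xs)) (+-monoʳ-≤ ⟦ q x ⟧ (⟦any⟧≤sum q xs))

  count-image≤ : ∀ {n k} (P : Fin n → Bool) (h : Fin n → Fin k) →
                 count (λ c → any (λ w → does (h w ≟ c) ∧ P w) (allFin n)) ≤ count P
  count-image≤ {n} {k} P h = begin
    count image
      ≡⟨ count≡∑ image ⟩
    ∑[ c < k ] ⟦ image c ⟧
      ≤⟨ ∑-mono-≤ (λ c → ≤-trans (⟦any⟧≤sum (hit c) (allFin n)) (≤-reflexive (sum-allFin (λ w → ⟦ hit c w ⟧)))) ⟩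
    ∑[ c < k ] ∑[ w < n ] ⟦ hit c w ⟧
      ≡⟨ ∑-comm (λ c w → ⟦ hit c w ⟧) ⟩
    ∑[ w < n ] ∑[ c < k ] ⟦ hit c w ⟧
      ≡⟨ sum-cong-≗ (λ w → trans (sum-cong-≗ (λ c → ⟦∧⟧ (does (h w ≟ c)) (P w))) (∑-δ (h w) (const ⟦ P w ⟧))) ⟩
    ∑[ w < n ] ⟦ P w ⟧
      ≡⟨ count≡∑ P ⟨
    count P ∎
    where
    open ≤-Reasoning
    hit : Fin k → Fin n → Bool
    hit c w = does (h w ≟ c) ∧ P w
    image : Fin k → Bool
    image c = any (hit c) (allFin n)

  module Moves {n : ℕ} (G : Graph n) (k : ℕ) where

    Colouring : Set
    Colouring = Fin n → Fin k

    Move : Set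
    Move = Fin n × Fin k

    recolour : Colouring → Move → Colouring
    recolour h (v , c) = updateAt h v (const c)

    recolour-at : ∀ h v c → recolour h (v , c) v ≡ c
    recolour-at h v c = updateAt-updates v h

    recolour-elsewhere : ∀ h v c {x} → x ≢ v → recolour h (v , c) x ≡ h x
    recolour-elsewhere h v c {x} = updateAt-minimal x v h

    run : Colouring → List Move → Colouring
    run = foldl recolour

    run-++ : ∀ h xs ys → run h (xs ++ ys) ≡ run (run h xs) ys
    run-++ = foldl-++ recolour

    ProperOn : (Fin n → Bool) → Colouring → Set
    ProperOn S h = ∀ u w → T (S u) → T (S w) → T (adj G u w) → h u ≢ h w

    Legal : (movers blockers : Fin n → Bool) → Colouring → List Move → Set
    Legal V B h []             = ⊤
    Legal V B h ((v , c) ∷ ms) =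
      T (V v) × (∀ u → T (B u) → T (adj G v u) → h u ≢ c) × Legal V B (recolour h (v , c)) ms

    Legal-++ : ∀ {V B} h xs ys → Legal V B h xs → Legal V B (run h xs) ys → Legal V B h (xs ++ ys)
    Legal-++ h []             ys _                  legal-ys = legal-ys
    Legal-++ h ((v , c) ∷ xs) ys (v∈V , free , legal) legal-ys =
      v∈V , free , Legal-++ (recolour h (v , c)) xs ys legal legal-ys

    Legal-mono : ∀ {V V′ B} → (∀ x → T (V x) → T (V′ x)) → ∀ h ms → Legal V B h ms → Legal V′ B h ms
    Legal-mono V⊆V′ h []             _                    = tt
    Legal-mono V⊆V′ h ((v , c) ∷ ms) (v∈V , free , legal) =
      V⊆V′ v v∈V , free , Legal-mono V⊆V′ (recolour h (v , c)) ms legal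

    Proper-recolour : ∀ {h v c} → Proper G k h → (∀ u → T (adj G v u) → h u ≢ c) →
                      Proper G k (recolour h (v , c))
    Proper-recolour {h} {v} {c} proper free x y xy with x ≟ v | y ≟ v
    ... | yes refl | yes refl = ⊥-elim (subst T (adj-irr G x) xy)
    ... | yes refl | no y≢v   rewrite recolour-at h v c | recolour-elsewhere h v c y≢v =
      λ c≡hy → free y xy (sym c≡hy)
    ... | no x≢v   | yes refl rewrite recolour-at h v c | recolour-elsewhere h v c x≢v =
      free x (subst T (adj-sym G x v) xy)
    ... | no x≢v   | no y≢v   rewrite recolour-elsewhere h v c x≢v | recolour-elsewhere h v c y≢v =
      proper x y xy

    Reach-resp : ∀ {L f f′ g} → (∀ x → f x ≡ f′ x) → Reach G k L f′ g → Reach G k L f g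
    Reach-resp f≗f′ (here f′≗g) = here (λ v → trans (f≗f′ v) (f′≗g v))
    Reach-resp f≗f′ (step proper (v , changed , same) r) =
      step proper (v , (λ eq → changed (trans (sym (f≗f′ v)) eq)) , λ u u≢v → trans (f≗f′ u) (same u u≢v)) r

    Reach-mono : ∀ {L L′ f g} → L ≤ L′ → Reach G k L f g → Reach G k L′ f g
    Reach-mono _         (here f≗g)          = here f≗g
    Reach-mono (s≤s L≤L′) (step proper δ r) = step proper δ (Reach-mono L≤L′ r)

    legal⇒Reach : ∀ {f g} ms → Proper G k f → Legal (const true) (const true) f ms →
                  (∀ x → run f ms x ≡ g x) → Reach G k (length ms) f g
    legal⇒Reach []             proper _                agrees = here agrees
    legal⇒Reach {f} ((v , c) ∷ ms) proper (_ , free , legal) agrees with f v ≟ c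
    ... | yes fv≡c = Reach-mono (n≤1+n _) (Reach-resp unchanged walk)
      where
      walk = legal⇒Reach ms (Proper-recolour proper (λ u → free u tt)) legal agrees
      unchanged : ∀ x → f x ≡ recolour f (v , c) x
      unchanged x with x ≟ v
      ... | yes refl = trans fv≡c (sym (recolour-at f v c))
      ... | no x≢v   = sym (recolour-elsewhere f v c x≢v)
    ... | no fv≢c = step proper′ (v , (λ eq → fv≢c (trans eq (recolour-at f v c))) ,
                                      λ u u≢v → sym (recolour-elsewhere f v c u≢v))
                         (legal⇒Reach ms proper′ legal agrees)
      where proper′ = Proper-recolour proper (λ u → free u tt)

    movesIn : (Fin n → Bool) → List Move → ℕ
    movesIn P []             = 0
    movesIn P ((v , _) ∷ ms) = ⟦ P v ⟧ + movesIn P ms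

    movesAt : Fin n → List Move → ℕ
    movesAt x = movesIn (λ v → does (v ≟ x))

    movesIn-++ : ∀ P xs ys → movesIn P (xs ++ ys) ≡ movesIn P xs + movesIn P ys
    movesIn-++ P []             ys = refl
    movesIn-++ P ((v , _) ∷ xs) ys = trans (cong (⟦ P v ⟧ +_) (movesIn-++ P xs ys)) (sym (+-assoc ⟦ P v ⟧ _ _))

    length≡movesIn : ∀ ms → length ms ≡ movesIn (const true) ms
    length≡movesIn []       = refl
    length≡movesIn (_ ∷ ms) = cong suc (length≡movesIn ms)

    movesIn≡∑ : ∀ P ms → movesIn P ms ≡ ∑[ u < n ] (⟦ P u ⟧ * movesAt u ms)
    movesIn≡∑ P [] = sym (trans (sum-cong-≗ (λ u → *-zeroʳ ⟦ P u ⟧)) (sum-replicate-zero n))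
    movesIn≡∑ P ((v , c) ∷ ms) = begin
      ⟦ P v ⟧ + movesIn P ms
        ≡⟨ cong₂ _+_ (∑-δ v (λ u → ⟦ P u ⟧)) (sym (movesIn≡∑ P ms)) ⟨
      ∑[ u < n ] (⟦ does (v ≟ u) ⟧ * ⟦ P u ⟧) + ∑[ u < n ] (⟦ P u ⟧ * movesAt u ms)
        ≡⟨ ∑-distrib-+ (λ u → ⟦ does (v ≟ u) ⟧ * ⟦ P u ⟧) (λ u → ⟦ P u ⟧ * movesAt u ms) ⟨
      ∑[ u < n ] (⟦ does (v ≟ u) ⟧ * ⟦ P u ⟧ + ⟦ P u ⟧ * movesAt u ms)
        ≡⟨ sum-cong-≗ (λ u → trans (cong (_+ ⟦ P u ⟧ * movesAt u ms) (*-comm ⟦ does (v ≟ u) ⟧ ⟦ P u ⟧))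
                                   (sym (*-distribˡ-+ ⟦ P u ⟧ ⟦ does (v ≟ u) ⟧ (movesAt u ms)))) ⟩
      ∑[ u < n ] (⟦ P u ⟧ * movesAt u ((v , c) ∷ ms)) ∎
      where open ≡-Reasoning

    movesIn≤count* : ∀ P ms {M} → (∀ u → movesAt u ms ≤ M) → movesIn P ms ≤ count P * M
    movesIn≤count* P ms {M} bounded = begin
      movesIn P ms                           ≡⟨ movesIn≡∑ P ms ⟩
      ∑[ u < n ] (⟦ P u ⟧ * movesAt u ms)    ≤⟨ ∑-mono-≤ (λ u → *-monoʳ-≤ ⟦ P u ⟧ (bounded u)) ⟩
      ∑[ u < n ] (⟦ P u ⟧ * M)               ≡⟨ *-distribʳ-sum M (λ u → ⟦ P u ⟧) ⟨
      (∑[ u < n ] ⟦ P u ⟧) * M               ≡⟨ cong (_* M) (count≡∑ P) ⟨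
      count P * M                            ∎
      where open ≤-Reasoning

    movesAt-nonmover : ∀ {V B} h ms x → Legal V B h ms → ¬ T (V x) → movesAt x ms ≡ 0
    movesAt-nonmover h []             x _                 _     = refl
    movesAt-nonmover h ((v , c) ∷ ms) x (v∈V , _ , legal) x∉V with v ≟ x
    ... | yes refl = contradiction v∈V x∉V
    ... | no _     = movesAt-nonmover (recolour h (v , c)) ms x legal x∉V

    record Schedule (S : Fin n → Bool) (f g : Colouring) (M : ℕ) : Set where
      field
        moves   : List Move
        legal   : Legal S S f moves
        reaches : ∀ x → T (S x) → run f moves x ≡ g x
        bounded : ∀ x → movesAt x moves ≤ M

    Schedule-mono : ∀ {S f g M M′} → M ≤ M′ → Schedule S f g M → Schedule S f g M′
    Schedule-mono M≤M′ σ = record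
      { moves = moves ; legal = legal ; reaches = reaches ; bounded = λ x → ≤-trans (bounded x) M≤M′ }
      where open Schedule σ

  module Layer {n : ℕ} (G : Graph n) (d : ℕ) (S : Fin n → Bool) where

    nbrIn : Fin n → Fin n → Bool
    nbrIn u w = S w ∧ adj G u w

    degIn : Fin n → ℕ
    degIn u = count (nbrIn u)

    low : Fin n → Bool
    low u = S u ∧ (degIn u <ᵇ d)

    rest : Fin n → Bool
    rest u = S u ∧ not (degIn u <ᵇ d)

    low⇒S : ∀ u → T (low u) → T (S u)
    low⇒S u = proj₁ ∘ Equivalence.to T-∧

    rest⇒S : ∀ u → T (rest u) → T (S u)
    rest⇒S u = proj₁ ∘ Equivalence.to T-∧

    low⇒degIn<d : ∀ u → T (low u) → degIn u < d
    low⇒degIn<d u = <ᵇ⇒< (degIn u) d ∘ proj₂ ∘ Equivalence.to T-∧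

    low⇒¬rest : ∀ u → T (low u) → ¬ T (rest u)
    low⇒¬rest u low-u rest-u with degIn u <ᵇ d
    ... | true  = proj₂ (Equivalence.to T-∧ rest-u)
    ... | false = proj₂ (Equivalence.to T-∧ low-u)

    S⇒low⊎rest : ∀ u → T (S u) → T (low u) ⊎ T (rest u)
    S⇒low⊎rest u S-u with S u | degIn u <ᵇ d
    ... | true | true  = inj₁ tt
    ... | true | false = inj₂ tt

    count-rest+low : count S ≡ count rest + count low
    count-rest+low = begin
      count S                                          ≡⟨ count≡∑ S ⟩
      ∑[ u < n ] ⟦ S u ⟧                               ≡⟨ sum-cong-≗ split ⟩
      ∑[ u < n ] (⟦ rest u ⟧ + ⟦ low u ⟧)              ≡⟨ ∑-distrib-+ (λ u → ⟦ rest u ⟧) (λ u → ⟦ low u ⟧) ⟩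
      ∑[ u < n ] ⟦ rest u ⟧ + ∑[ u < n ] ⟦ low u ⟧     ≡⟨ cong₂ _+_ (count≡∑ rest) (count≡∑ low) ⟨
      count rest + count low                           ∎
      where
      open ≡-Reasoning
      split : ∀ u → ⟦ S u ⟧ ≡ ⟦ rest u ⟧ + ⟦ low u ⟧
      split u with S u | degIn u <ᵇ d
      ... | false | _     = refl
      ... | true  | true  = refl
      ... | true  | false = refl

  module Push {n : ℕ} (G : Graph n) {k d : ℕ} (d<k : d < k) (S : Fin n → Bool) where

    open Moves G k
    open Layer G d S

    blocked : Colouring → Fin n → Fin k → Fin k → Bool
    blocked h u c c′ = does (c ≟ c′) ∨ any (λ w → does (h w ≟ c′) ∧ nbrIn u w) (allFin n)

    count-blocked : ∀ h u c → count (blocked h u c) ≤ 1 + degIn u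
    count-blocked h u c = begin
      count (blocked h u c)
        ≡⟨ count≡∑ (blocked h u c) ⟩
      ∑[ c′ < k ] ⟦ blocked h u c c′ ⟧
        ≤⟨ ∑-mono-≤ (λ c′ → ⟦∨⟧ (does (c ≟ c′)) (image c′)) ⟩
      ∑[ c′ < k ] (⟦ does (c ≟ c′) ⟧ + ⟦ image c′ ⟧)
        ≡⟨ ∑-distrib-+ (λ c′ → ⟦ does (c ≟ c′) ⟧) (λ c′ → ⟦ image c′ ⟧) ⟩
      ∑[ c′ < k ] ⟦ does (c ≟ c′) ⟧ + ∑[ c′ < k ] ⟦ image c′ ⟧
        ≡⟨ cong₂ _+_ (trans (sum-cong-≗ (λ c′ → sym (*-identityʳ ⟦ does (c ≟ c′) ⟧))) (∑-δ c (const 1)))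
                     (sym (count≡∑ image)) ⟩
      1 + count image
        ≤⟨ +-monoʳ-≤ 1 (count-image≤ (nbrIn u) h) ⟩
      1 + degIn u ∎
      where
      open ≤-Reasoning
      image : Fin k → Bool
      image c′ = any (λ w → does (h w ≟ c′) ∧ nbrIn u w) (allFin n)

    FreeFor : Colouring → Fin n → Fin k → Fin k → Set
    FreeFor h u c c′ = c′ ≢ c × (∀ w → T (S w) → T (adj G u w) → h w ≢ c′)

    freeColour : ∀ h u c → T (low u) → Σ[ c′ ∈ Fin k ] FreeFor h u c c′
    freeColour h u c low-u with count<⇒∃¬ (blocked h u c) few-blocked
      where
      few-blocked : count (blocked h u c) < k
      few-blocked = ≤-<-trans (count-blocked h u c) (≤-trans (s≤s (low⇒degIn<d u low-u)) d<k)
    ... | c′ , unblocked = c′ , c′≢c , unused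
      where
      c′≢c : c′ ≢ c
      c′≢c refl = unblocked (Equivalence.from T-∨ (inj₁ (T-does (c′ ≟ c′) refl)))
      unused : ∀ w → T (S w) → T (adj G u w) → h w ≢ c′
      unused w S-w uw hw≡c′ =
        unblocked (Equivalence.from T-∨ (inj₂ (any⁺ colours-c′ (Any.map (λ { refl → w-has-c′ }) (∈-allFin w)))))
        where
        colours-c′ : Fin n → Bool
        colours-c′ w′ = does (h w′ ≟ c′) ∧ (S w′ ∧ adj G u w′)
        w-has-c′ : T (colours-c′ w)
        w-has-c′ = Equivalence.from T-∧ (T-does (h w ≟ c′) hw≡c′ , Equivalence.from T-∧ (S-w , uw))

    free : ∀ h u c → T (low u) → Fin k
    free h u c low-u = proj₁ (freeColour h u c low-u)

    module _ (v : Fin n) (c : Fin k) where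

      Pushable : Colouring → Fin n → Set
      Pushable h u = T (low u) × T (adj G v u) × h u ≡ c

      pushable? : ∀ h u → Dec (Pushable h u)
      pushable? h u = T? (low u) ×-dec T? (adj G v u) ×-dec h u ≟ c

      pushes : List (Fin n) → Colouring → List Move
      pushes []       h = []
      pushes (u ∷ us) h with pushable? h u
      ... | yes (low-u , _) = (u , free h u c low-u) ∷ pushes us (recolour h (u , free h u c low-u))
      ... | no _            = pushes us h

      pushes-legal : ∀ us h → Legal S S h (pushes us h)
      pushes-legal []       h = tt
      pushes-legal (u ∷ us) h with pushable? h u
      ... | yes (low-u , _) = low⇒S u low-u , proj₂ (proj₂ (freeColour h u c low-u)) , pushes-legal us _
      ... | no _            = pushes-legal us h

      pushes-frame : ∀ us h x → ¬ Pushable h x → run h (pushes us h) x ≡ h x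
      pushes-frame []       h x _ = refl
      pushes-frame (u ∷ us) h x ¬push with pushable? h u
      ... | no _ = pushes-frame us h x ¬push
      ... | yes push-u@(low-u , _) with x ≟ u
      ...   | yes refl = contradiction push-u ¬push
      ...   | no x≢u   = trans (pushes-frame us h′ x ¬push′) (recolour-elsewhere h u _ x≢u)
        where
        h′ = recolour h (u , free h u c low-u)
        ¬push′ : ¬ Pushable h′ x
        ¬push′ (low-x , vx , h′x≡c) = ¬push (low-x , vx , trans (sym (recolour-elsewhere h u _ x≢u)) h′x≡c)

      pushes-keeps-≢ : ∀ us h x → h x ≢ c → run h (pushes us h) x ≢ c
      pushes-keeps-≢ us h x hx≢c rewrite pushes-frame us h x (λ (_ , _ , hx≡c) → hx≢c hx≡c) = hx≢c

      pushes-clears : ∀ us h x → x ∈ us → T (low x) → T (adj G v x) → run h (pushes us h) x ≢ c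
      pushes-clears (u ∷ us) h x x∈ low-x vx with pushable? h u
      pushes-clears (u ∷ us) h x (here refl) low-x vx | yes (low-u , _) =
        pushes-keeps-≢ us _ x (subst (_≢ c) (sym (recolour-at h x _)) (proj₁ (proj₂ (freeColour h x c low-u))))
      pushes-clears (u ∷ us) h x (here refl) low-x vx | no ¬push =
        pushes-keeps-≢ us h x (λ hx≡c → ¬push (low-x , vx , hx≡c))
      pushes-clears (u ∷ us) h x (there x∈) low-x vx | yes (low-u , _) = pushes-clears us _ x x∈ low-x vx
      pushes-clears (u ∷ us) h x (there x∈) low-x vx | no _            = pushes-clears us h x x∈ low-x vx

      movesIn-pushes : ∀ P us h →
                       movesIn P (pushes us h) ≤ ListAction.sum (map (λ u → ⟦ P u ⟧ * ⟦ low u ∧ adj G v u ⟧) us)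
      movesIn-pushes P []       h = z≤n
      movesIn-pushes P (u ∷ us) h with pushable? h u
      ... | yes (low-u , vu , _) =
        +-mono-≤ (≤-reflexive (trans (sym (*-identityʳ ⟦ P u ⟧))
                                     (cong (⟦ P u ⟧ *_) (sym (T⇒⟦⟧≡1 (Equivalence.from T-∧ (low-u , vu)))))))
                 (movesIn-pushes P us _)
      ... | no _ = ≤-trans (movesIn-pushes P us h) (m≤n+m _ _)

      movesAt-pushes : ∀ h x → movesAt x (pushes (allFin n) h) ≤ ⟦ low x ∧ adj G v x ⟧
      movesAt-pushes h x = ≤-trans (movesIn-pushes (λ u → does (u ≟ x)) (allFin n) h)
                                   (≤-reflexive (sum-δ-allFin x (λ u → ⟦ low u ∧ adj G v u ⟧)))

    AgreeOnRest : Colouring → Colouring → Set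
    AgreeOnRest h h′ = ∀ x → T (rest x) → h x ≡ h′ x

    pushes-agree : ∀ {h h′} v c → AgreeOnRest h h′ → AgreeOnRest (run h (pushes v c (allFin n) h)) h′
    pushes-agree {h} v c agree x rest-x =
      trans (pushes-frame v c (allFin n) h x (λ (low-x , _) → low⇒¬rest x low-x rest-x)) (agree x rest-x)

    recolour-agree : ∀ {h h′} m → AgreeOnRest h h′ → AgreeOnRest (recolour h m) (recolour h′ m)
    recolour-agree {h} {h′} (v , c) agree x rest-x with x ≟ v
    ... | yes refl = trans (recolour-at h x c) (sym (recolour-at h′ x c))
    ... | no x≢v   = trans (recolour-elsewhere h v c x≢v) (trans (agree x rest-x) (sym (recolour-elsewhere h′ v c x≢v)))

    lift : Colouring → List Move → List Move
    lift h []             = []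
    lift h ((v , c) ∷ ms) = ps ++ (v , c) ∷ lift (recolour (run h ps) (v , c)) ms
      where ps = pushes v c (allFin n) h

    run-lift : ∀ h v c ms → let ps = pushes v c (allFin n) h in
               run h (lift h ((v , c) ∷ ms)) ≡ run (recolour (run h ps) (v , c)) (lift (recolour (run h ps) (v , c)) ms)
    run-lift h v c ms = run-++ h (pushes v c (allFin n) h) _

    lift-agrees : ∀ ms {h hL} → AgreeOnRest hL h → AgreeOnRest (run hL (lift hL ms)) (run h ms)
    lift-agrees []             agree = agree
    lift-agrees ((v , c) ∷ ms) {hL = hL} agree x rest-x =
      trans (cong (λ h′ → h′ x) (run-lift hL v c ms))
            (lift-agrees ms (recolour-agree (v , c) (pushes-agree v c agree)) x rest-x)

    lift-legal : ∀ ms {h hL} → AgreeOnRest hL h → Legal S rest h ms → Legal S S hL (lift hL ms)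
    lift-legal []             agree _ = tt
    lift-legal ((v , c) ∷ ms) {h} {hL} agree (v∈S , free-rest , legal) =
      Legal-++ hL ps _ (pushes-legal v c (allFin n) hL)
               (v∈S , free-S , lift-legal ms (recolour-agree (v , c) agree₁) legal)
      where
      ps = pushes v c (allFin n) hL
      agree₁ : AgreeOnRest (run hL ps) h
      agree₁ = pushes-agree v c agree
      free-S : ∀ u → T (S u) → T (adj G v u) → run hL ps u ≢ c
      free-S u S-u vu with S⇒low⊎rest u S-u
      ... | inj₁ low-u  = pushes-clears v c (allFin n) hL u (∈-allFin u) low-u vu
      ... | inj₂ rest-u = λ eq → free-rest u rest-u vu (trans (sym (agree₁ u rest-u)) eq)

    movesAt-lift : ∀ {B} ms h hL x → Legal S B h ms →
                   movesAt x (lift hL ms) ≤ movesAt x ms + ⟦ low x ⟧ * movesIn (nbrIn x) ms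
    movesAt-lift []             h hL x _                 = z≤n
    movesAt-lift ((v , c) ∷ ms) h hL x (v∈S , _ , legal) = begin
      movesAt x (ps ++ (v , c) ∷ lift h₂ ms)
        ≡⟨ movesIn-++ _ ps _ ⟩
      movesAt x ps + (E + movesAt x (lift h₂ ms))
        ≤⟨ +-mono-≤ (movesAt-pushes v c hL x) (+-monoʳ-≤ E (movesAt-lift ms _ h₂ x legal)) ⟩
      ⟦ low x ∧ adj G v x ⟧ + (E + (M + L * R))
        ≡⟨ cong (_+ (E + (M + L * R))) pushed⇔neighbour ⟩
      L * A + (E + (M + L * R))
        ≡⟨ solve 5 (λ L A E M R → L :* A :+ (E :+ (M :+ L :* R)) := (E :+ M) :+ L :* (A :+ R)) refl L A E M R ⟩
      (E + M) + L * (A + R) ∎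
      where
      open ≤-Reasoning
      open +-*-Solver using (solve; _:+_; _:*_; _:=_)
      ps = pushes v c (allFin n) hL
      h₂ = recolour (run hL ps) (v , c)
      L = ⟦ low x ⟧
      A = ⟦ S v ∧ adj G x v ⟧
      E = ⟦ does (v ≟ x) ⟧
      M = movesAt x ms
      R = movesIn (λ w → S w ∧ adj G x w) ms
      pushed⇔neighbour : ⟦ low x ∧ adj G v x ⟧ ≡ L * A
      pushed⇔neighbour = trans (⟦∧⟧ (low x) (adj G v x))
                               (cong (L *_) (trans (cong ⟦_⟧ (adj-sym G v x)) (sym (⟦T∧⟧ (adj G x v) v∈S))))

    fixLow : Colouring → List (Fin n) → List Move
    fixLow g []       = []
    fixLow g (a ∷ as) = if low a then (a , g a) ∷ fixLow g as else fixLow g as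

    fixLow-legal : ∀ {g} as h → ProperOn S g → AgreeOnRest h g → Legal S rest h (fixLow g as)
    fixLow-legal         []       h proper agree = tt
    fixLow-legal {g} (a ∷ as) h proper agree with low a in low-a≡true
    ... | false = fixLow-legal as h proper agree
    ... | true  = low⇒S a low-a , free-rest , fixLow-legal as _ proper agree′
      where
      low-a : T (low a)
      low-a = subst T (sym low-a≡true) tt
      free-rest : ∀ u → T (rest u) → T (adj G a u) → h u ≢ g a
      free-rest u rest-u au hu≡ga =
        proper a u (low⇒S a low-a) (rest⇒S u rest-u) au (sym (trans (sym (agree u rest-u)) hu≡ga))
      agree′ : AgreeOnRest (recolour h (a , g a)) g
      agree′ x rest-x with x ≟ a
      ... | yes refl = recolour-at h x (g x)
      ... | no x≢a   = trans (recolour-elsewhere h a (g a) x≢a) (agree x rest-x)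

    movesIn-fixLow : ∀ g P as → movesIn P (fixLow g as) ≤ ListAction.sum (map (λ a → ⟦ P a ⟧ * ⟦ low a ⟧) as)
    movesIn-fixLow g P []       = z≤n
    movesIn-fixLow g P (a ∷ as) with low a
    ... | true  = +-mono-≤ (≤-reflexive (sym (*-identityʳ ⟦ P a ⟧))) (movesIn-fixLow g P as)
    ... | false = ≤-trans (movesIn-fixLow g P as) (m≤n+m _ _)

    movesAt-fixLow : ∀ g x → movesAt x (fixLow g (allFin n)) ≤ ⟦ low x ⟧
    movesAt-fixLow g x = ≤-trans (movesIn-fixLow g (λ a → does (a ≟ x)) (allFin n))
                                 (≤-reflexive (sum-δ-allFin x (λ a → ⟦ low a ⟧)))

    lift-fixLow-settles : ∀ {g} → ProperOn S g → ∀ as h y → T (S y) → h y ≡ g y ⊎ (y ∈ as × T (low y)) →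
                          run h (lift h (fixLow g as)) y ≡ g y
    lift-fixLow-settles proper []       h y S-y (inj₁ hy≡gy) = hy≡gy
    lift-fixLow-settles {g} proper (a ∷ as) h y S-y settled with low a in low-a≡
    ... | false = lift-fixLow-settles proper as h y S-y (skip settled)
      where
      skip : h y ≡ g y ⊎ (y ∈ a ∷ as × T (low y)) → h y ≡ g y ⊎ (y ∈ as × T (low y))
      skip (inj₁ hy≡gy)             = inj₁ hy≡gy
      skip (inj₂ (here y≡a , low-y)) = ⊥-elim (subst T low-a≡ (subst (T ∘ low) y≡a low-y))
      skip (inj₂ (there y∈ , low-y)) = inj₂ (y∈ , low-y)
    ... | true = trans (cong (λ h′ → h′ y) (run-lift h a (g a) (fixLow g as)))
                       (lift-fixLow-settles proper as h₂ y S-y (settle (y ≟ a) settled))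
      where
      ps = pushes a (g a) (allFin n) h
      h₂ = recolour (run h ps) (a , g a)
      settle : Dec (y ≡ a) → h y ≡ g y ⊎ (y ∈ a ∷ as × T (low y)) → h₂ y ≡ g y ⊎ (y ∈ as × T (low y))
      settle (yes refl) _                         = inj₁ (recolour-at (run h ps) a (g a))
      settle (no y≢a)   (inj₂ (here y≡a , _))     = contradiction y≡a y≢a
      settle (no y≢a)   (inj₂ (there y∈ , low-y)) = inj₂ (y∈ , low-y)
      settle (no y≢a)   (inj₁ hy≡gy)              = inj₁ (begin
        h₂ y         ≡⟨ recolour-elsewhere (run h ps) a (g a) y≢a ⟩
        run h ps y   ≡⟨ pushes-frame a (g a) (allFin n) h y not-pushed ⟩
        h y          ≡⟨ hy≡gy ⟩
        g y          ∎)
        where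
        open ≡-Reasoning
        not-pushed : ¬ Pushable a (g a) h y
        not-pushed (low-y , ay , hy≡ga) =
          proper a y (low⇒S a (subst T (sym low-a≡) tt)) S-y ay (sym (trans (sym hy≡gy) hy≡ga))

    movesAt-peel : ∀ {h M} ms fix x → 1 ≤ d → Legal rest rest h ms →
                   (∀ u → movesAt u ms ≤ M) → (∀ u → movesAt u fix ≤ ⟦ low u ⟧) →
                   (movesAt x ms + ⟦ low x ⟧ * movesIn (nbrIn x) ms) + (movesAt x fix + ⟦ low x ⟧ * movesIn (nbrIn x) fix)
                     ≤ d * (M + 1)
    movesAt-peel {h} {M} ms fix x 1≤d legal ms-bounded fix-bounded = by-layer (low x) refl
      where
      open ≤-Reasoning
      D = degIn x
      by-layer : ∀ b → low x ≡ b →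
                 (movesAt x ms + ⟦ b ⟧ * movesIn (nbrIn x) ms) + (movesAt x fix + ⟦ b ⟧ * movesIn (nbrIn x) fix)
                   ≤ d * (M + 1)
      by-layer false low-x≡ = begin
        (movesAt x ms + 0) + (movesAt x fix + 0)
          ≤⟨ +-mono-≤ (+-monoˡ-≤ 0 (ms-bounded x)) (+-monoˡ-≤ 0 (subst (movesAt x fix ≤_) (cong ⟦_⟧ low-x≡) (fix-bounded x))) ⟩
        (M + 0) + (0 + 0)
          ≡⟨ trans (+-identityʳ _) (+-identityʳ M) ⟩
        M
          ≤⟨ m≤m+n M 1 ⟩
        M + 1
          ≡⟨ *-identityˡ (M + 1) ⟨
        1 * (M + 1)
          ≤⟨ *-monoˡ-≤ (M + 1) 1≤d ⟩
        d * (M + 1) ∎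
      by-layer true low-x≡ = begin
        (movesAt x ms + 1 * movesIn (nbrIn x) ms) + (movesAt x fix + 1 * movesIn (nbrIn x) fix)
          ≤⟨ +-mono-≤ (+-mono-≤ (≤-reflexive (movesAt-nonmover h ms x legal (low⇒¬rest x low-x)))
                                (*-monoʳ-≤ 1 (movesIn≤count* (nbrIn x) ms ms-bounded)))
                      (+-mono-≤ (subst (movesAt x fix ≤_) (cong ⟦_⟧ low-x≡) (fix-bounded x))
                                (*-monoʳ-≤ 1 (movesIn≤count* (nbrIn x) fix (λ u → ≤-trans (fix-bounded u) (⟦⟧≤1 (low u)))))) ⟩
        (0 + 1 * (D * M)) + (1 + 1 * (D * 1))
          ≤⟨ m≤m+n _ M ⟩
        (0 + 1 * (D * M)) + (1 + 1 * (D * 1)) + M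
          ≡⟨ solve 2 (λ D M → (con 0 :+ con 1 :* (D :* M)) :+ (con 1 :+ con 1 :* (D :* con 1)) :+ M
                              := (con 1 :+ D) :* (M :+ con 1)) refl D M ⟩
        (1 + D) * (M + 1)
          ≤⟨ *-monoˡ-≤ (M + 1) (low⇒degIn<d x low-x) ⟩
        d * (M + 1) ∎
        where
        open +-*-Solver using (solve; _:+_; _:*_; _:=_; con)
        low-x : T (low x)
        low-x = subst T (sym low-x≡) tt

    peel : ∀ {f g M} → 1 ≤ d → ProperOn S g → Schedule rest f g M → Schedule S f g (d * (M + 1))
    peel {f} {g} {M} 1≤d proper σ = record
      { moves   = ms₁ ++ ms₂
      ; legal   = Legal-++ f ms₁ ms₂ legal₁ legal₂
      ; reaches = λ y S-y → trans (cong (λ h → h y) (run-++ f ms₁ ms₂))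
                                  (lift-fixLow-settles proper (allFin n) h₁ y S-y (settled y S-y))
      ; bounded = λ x → begin
          movesAt x (ms₁ ++ ms₂)
            ≡⟨ movesIn-++ _ ms₁ ms₂ ⟩
          movesAt x ms₁ + movesAt x ms₂
            ≤⟨ +-mono-≤ (movesAt-lift moves f f x legal₀) (movesAt-lift fix h₁ h₁ x fix-legal) ⟩
          (movesAt x moves + ⟦ low x ⟧ * movesIn (nbrIn x) moves) + (movesAt x fix + ⟦ low x ⟧ * movesIn (nbrIn x) fix)
            ≤⟨ movesAt-peel moves fix x 1≤d legal bounded (movesAt-fixLow g) ⟩
          d * (M + 1) ∎
      }
      where
      open ≤-Reasoning
      open Schedule σ
      legal₀ : Legal S rest f moves
      legal₀ = Legal-mono rest⇒S f moves legal
      ms₁ = lift f moves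
      legal₁ = lift-legal moves (λ _ _ → refl) legal₀
      h₁ = run f ms₁
      agree₁ : AgreeOnRest h₁ g
      agree₁ x rest-x = trans (lift-agrees moves (λ _ _ → refl) x rest-x) (reaches x rest-x)
      fix = fixLow g (allFin n)
      fix-legal : Legal S rest h₁ fix
      fix-legal = fixLow-legal (allFin n) h₁ proper agree₁
      ms₂ = lift h₁ fix
      legal₂ = lift-legal fix (λ _ _ → refl) fix-legal
      settled : ∀ y → T (S y) → h₁ y ≡ g y ⊎ (y ∈ allFin n × T (low y))
      settled y S-y with S⇒low⊎rest y S-y
      ... | inj₁ low-y  = inj₂ (∈-allFin y , low-y)
      ... | inj₂ rest-y = inj₁ (agree₁ y rest-y)

  ^-distrib-* : ∀ a b c → (a * b) ^ c ≡ a ^ c * b ^ c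
  ^-distrib-* a b zero    = refl
  ^-distrib-* a b (suc c) = begin
    a * b * (a * b) ^ c      ≡⟨ cong (a * b *_) (^-distrib-* a b c) ⟩
    a * b * (a ^ c * b ^ c)  ≡⟨ solve 4 (λ a b x y → a :* b :* (x :* y) := a :* x :* (b :* y)) refl a b (a ^ c) (b ^ c) ⟩
    a * a ^ c * (b * b ^ c)  ∎
    where
    open ≡-Reasoning
    open +-*-Solver

  bernoulli : ∀ N j → N ^ j * (N + j) ≤ N * suc N ^ j
  bernoulli N zero    = ≤-reflexive (trans (+-identityʳ (N + 0)) (trans (+-identityʳ N) (sym (*-identityʳ N))))
  bernoulli N (suc j) = begin
    N * N ^ j * (N + suc j)
      ≡⟨ solve 3 (λ N X j → N :* X :* (N :+ (con 1 :+ j)) := X :* N :* (N :+ j) :+ X :* N) refl N (N ^ j) j ⟩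
    N ^ j * N * (N + j) + N ^ j * N
      ≤⟨ +-monoʳ-≤ (N ^ j * N * (N + j)) (*-monoʳ-≤ (N ^ j) (m≤m+n N j)) ⟩
    N ^ j * N * (N + j) + N ^ j * (N + j)
      ≡⟨ solve 3 (λ N X Y → X :* N :* Y :+ X :* Y := (con 1 :+ N) :* (X :* Y)) refl N (N ^ j) (N + j) ⟩
    suc N * (N ^ j * (N + j))
      ≤⟨ *-monoʳ-≤ (suc N) (bernoulli N j) ⟩
    suc N * (N * suc N ^ j)
      ≡⟨ solve 3 (λ N M X → M :* (N :* X) := N :* (M :* X)) refl N (suc N) (suc N ^ j) ⟩
    N * (suc N * suc N ^ j) ∎
    where
    open ≤-Reasoning
    open +-*-Solver

  -- With c = N(d + 1), Bernoulli gives (1 + 1/N)^c ≥ 1 + c/N = d + 2.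
  power-gap : ∀ N d .{{_ : NonZero N}} → (d + 1) * N ^ (N * (d + 1)) ≤ suc N ^ (N * (d + 1))
  power-gap N d = *-cancelˡ-≤ N (begin
    N * ((d + 1) * N ^ c)         ≤⟨ *-monoʳ-≤ N (*-monoˡ-≤ (N ^ c) (n≤1+n (d + 1))) ⟩
    N * (suc (d + 1) * N ^ c)     ≡⟨ solve 3 (λ N X D → N :* ((con 1 :+ D) :* X) := X :* (N :+ N :* D)) refl N (N ^ c) (d + 1) ⟩
    N ^ c * (N + c)               ≤⟨ bernoulli N c ⟩
    N * suc N ^ c                 ∎)
    where
    open ≤-Reasoning
    open +-*-Solver
    c = N * (d + 1)

  dilute : ∀ N m′ s → m′ + s ≤ N * s → suc N * m′ ≤ N * (m′ + s)
  dilute N m′ s m≤Ns = +-cancelʳ-≤ (m′ + s) (suc N * m′) (N * (m′ + s)) (begin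
    suc N * m′ + (m′ + s)        ≤⟨ +-monoʳ-≤ (suc N * m′) (≤-trans m≤Ns (*-monoˡ-≤ s (n≤1+n N))) ⟩
    suc N * m′ + suc N * s       ≡⟨ *-distribˡ-+ (suc N) m′ s ⟨
    suc N * (m′ + s)             ≡⟨ +-comm (m′ + s) (N * (m′ + s)) ⟩
    N * (m′ + s) + (m′ + s)      ∎)
    where open ≤-Reasoning

  power-shrink : ∀ N d m′ m .{{_ : NonZero N}} → suc N * m′ ≤ N * m → (d + 1) * m′ ^ (N * (d + 1)) ≤ m ^ (N * (d + 1))
  power-shrink N d m′ m lin = *-cancelʳ-≤ _ _ (suc N ^ c) {{m^n≢0 (suc N) c}} (begin
    (d + 1) * m′ ^ c * suc N ^ c   ≡⟨ solve 3 (λ a x y → a :* x :* y := a :* (y :* x)) refl (d + 1) (m′ ^ c) (suc N ^ c) ⟩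
    (d + 1) * (suc N ^ c * m′ ^ c) ≡⟨ cong ((d + 1) *_) (^-distrib-* (suc N) m′ c) ⟨
    (d + 1) * (suc N * m′) ^ c     ≤⟨ *-monoʳ-≤ (d + 1) (^-monoˡ-≤ c lin) ⟩
    (d + 1) * (N * m) ^ c          ≡⟨ cong ((d + 1) *_) (^-distrib-* N m c) ⟩
    (d + 1) * (N ^ c * m ^ c)      ≡⟨ *-assoc (d + 1) (N ^ c) (m ^ c) ⟨
    (d + 1) * N ^ c * m ^ c        ≤⟨ *-monoˡ-≤ (m ^ c) (power-gap N d) ⟩
    suc N ^ c * m ^ c              ≡⟨ *-comm (suc N ^ c) (m ^ c) ⟩
    m ^ c * suc N ^ c              ∎)
    where
    open ≤-Reasoning
    open +-*-Solver
    c = N * (d + 1)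

  peel-bound : ∀ N d m′ s .{{_ : NonZero N}} → m′ + s ≤ N * s → 0 < m′ + s →
               d * m′ ^ (N * (d + 1)) + 1 ≤ (m′ + s) ^ (N * (d + 1))
  peel-bound N d zero s _ 0<s =
    subst (_≤ s ^ c) (cong (_+ 1) (sym (trans (cong (d *_) (0^c≡0 {{m*n≢0 N (d + 1)}})) (*-zeroʳ d))))
          (m^n>0 s {{>-nonZero 0<s}} c)
    where
    c = N * (d + 1)
    instance
      d+1≢0 : NonZero (d + 1)
      d+1≢0 = >-nonZero (m≤n+m 1 d)
    0^c≡0 : ∀ {c} .{{_ : NonZero c}} → 0 ^ c ≡ 0
    0^c≡0 {suc _} = refl
  peel-bound N d m′@(suc _) s m≤Ns _ = begin
    d * m′ ^ c + 1          ≤⟨ +-monoʳ-≤ (d * m′ ^ c) (m^n>0 m′ c) ⟩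
    d * m′ ^ c + m′ ^ c     ≡⟨ solve 2 (λ d x → d :* x :+ x := (d :+ con 1) :* x) refl d (m′ ^ c) ⟩
    (d + 1) * m′ ^ c        ≤⟨ power-shrink N d m′ (m′ + s) (dilute N m′ s m≤Ns) ⟩
    (m′ + s) ^ c            ∎
    where
    open ≤-Reasoning
    open +-*-Solver
    c = N * (d + 1)

  Peelable : ∀ {n} → Graph n → ℕ → ℕ → Set
  Peelable {n} G d N = ∀ (S : Fin n → Bool) → count S ≤ N * count (Layer.low G d S)

  module Recolouring {n : ℕ} (G : Graph n) {k d N : ℕ} .{{_ : NonZero N}}
                     (d<k : d < k) (1≤d : 1 ≤ d) (peelable : Peelable G d N) where

    open Moves G k

    exponent : ℕ
    exponent = N * (d + 1)

    schedule : ∀ t S → count S ≤ t → ∀ f {g} → ProperOn S g → Schedule S f g (d * count S ^ exponent)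
    schedule t S _ f proper with count S in |S|≡
    ... | zero = record
      { moves   = []
      ; legal   = tt
      ; reaches = λ x S-x → ⊥-elim (count≡0⇒¬ S |S|≡ x S-x)
      ; bounded = λ _ → z≤n
      }
    schedule (suc t) S |S|≤t f {g} proper | suc m =
      Schedule-mono (*-monoʳ-≤ d shrinks) (peel 1≤d proper σ)
      where
      open Layer G d S
      open Push G d<k S using (peel)
      |S|≡|rest|+|low| : suc m ≡ count rest + count low
      |S|≡|rest|+|low| = trans (sym |S|≡) count-rest+low
      |S|≤N|low| : count rest + count low ≤ N * count low
      |S|≤N|low| = subst (_≤ N * count low) count-rest+low (peelable S)
      |rest|≤t : count rest ≤ t
      |rest|≤t = ≤-pred (≤-trans (subst (count rest <_) (sym |S|≡|rest|+|low|) (m<m+n (count rest) 0<|low|)) |S|≤t)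
        where
        0<|low| : 0 < count low
        0<|low| = >-nonZero⁻¹ (count low)
          {{m*n≢0⇒n≢0 N {{>-nonZero (≤-trans (subst (0 <_) |S|≡|rest|+|low| z<s) |S|≤N|low|)}}}}
      σ : Schedule rest f g (d * count rest ^ exponent)
      σ = schedule t rest |rest|≤t f (λ u w rest-u rest-w → proper u w (rest⇒S u rest-u) (rest⇒S w rest-w))
      shrinks : d * count rest ^ exponent + 1 ≤ suc m ^ exponent
      shrinks = subst (λ m → d * count rest ^ exponent + 1 ≤ m ^ exponent) (sym |S|≡|rest|+|low|)
                      (peel-bound N d (count rest) (count low) |S|≤N|low| (subst (0 <_) |S|≡|rest|+|low| z<s))

    recolouring : ∀ {f g} → Proper G k f → Proper G k g → Reach G k (d * n ^ suc exponent) f g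
    recolouring {f} {g} proper-f proper-g =
      Reach-mono length-bound (legal⇒Reach moves proper-f legal (λ x → reaches x tt))
      where
      V : Fin n → Bool
      V = const true
      |V|≡n : count V ≡ n
      |V|≡n = count-all V (λ _ → tt)
      open Schedule (schedule n V (≤-reflexive |V|≡n) f (λ u w _ _ → proper-g u w))
      length-bound : length moves ≤ d * n ^ suc exponent
      length-bound = begin
        length moves                        ≡⟨ length≡movesIn moves ⟩
        movesIn V moves                     ≤⟨ movesIn≤count* V moves bounded ⟩
        count V * (d * count V ^ exponent)  ≡⟨ cong (λ m → m * (d * m ^ exponent)) |V|≡n ⟩
        n * (d * n ^ exponent)              ≡⟨ x∙yz≈y∙xz n d (n ^ exponent) ⟩
        d * n ^ suc exponent                ∎
        where open ≤-Reasoning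

  edges-irr : ∀ {n} {G : Graph n} (H : Subgraph G) u → edges H u u ≡ false
  edges-irr {G = G} H u with edges H u u in uu
  ... | false = refl
  ... | true  = ⊥-elim (subst T (adj-irr G u) (proj₁ (edges-⊆ H u u (subst T (sym uu) tt))))

  handshake : ∀ {n} {G : Graph n} (H : Subgraph G) → ∑[ u < n ] count (edges H u) ≡ |E| H + |E| H
  handshake {n} H = begin
    ∑[ u < n ] count (edges H u)
      ≡⟨ sum-cong-≗ (λ u → trans (count≡∑ (edges H u)) (sum-cong-≗ (split u))) ⟩
    ∑[ u < n ] ∑[ v < n ] (⟦ below u v ⟧ + ⟦ below v u ⟧)
      ≡⟨ sum-cong-≗ (λ u → ∑-distrib-+ (λ v → ⟦ below u v ⟧) (λ v → ⟦ below v u ⟧)) ⟩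
    ∑[ u < n ] (∑[ v < n ] ⟦ below u v ⟧ + ∑[ v < n ] ⟦ below v u ⟧)
      ≡⟨ ∑-distrib-+ (λ u → ∑[ v < n ] ⟦ below u v ⟧) (λ u → ∑[ v < n ] ⟦ below v u ⟧) ⟩
    ∑[ u < n ] ∑[ v < n ] ⟦ below u v ⟧ + ∑[ u < n ] ∑[ v < n ] ⟦ below v u ⟧
      ≡⟨ cong (∑[ u < n ] ∑[ v < n ] ⟦ below u v ⟧ +_) (∑-comm (λ u v → ⟦ below v u ⟧)) ⟩
    ∑[ u < n ] ∑[ v < n ] ⟦ below u v ⟧ + ∑[ v < n ] ∑[ u < n ] ⟦ below v u ⟧
      ≡⟨ cong₂ _+_ |E|≡∑ |E|≡∑ ⟨
    |E| H + |E| H ∎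
    where
    open ≡-Reasoning
    below : Fin n → Fin n → Bool
    below u v = if toℕ u <ᵇ toℕ v then edges H u v else false
    |E|≡∑ : |E| H ≡ ∑[ u < n ] ∑[ v < n ] ⟦ below u v ⟧
    |E|≡∑ = trans (sum-allFin (λ u → count (below u))) (sum-cong-≗ (λ u → count≡∑ (below u)))
    split : ∀ u v → ⟦ edges H u v ⟧ ≡ ⟦ below u v ⟧ + ⟦ below v u ⟧
    split u v with toℕ u <ᵇ toℕ v in u<v | toℕ v <ᵇ toℕ u in v<u
    ... | true  | true  = contradiction (<ᵇ⇒< (toℕ u) (toℕ v) (subst T (sym u<v) tt))
                                        (<⇒≯ (<ᵇ⇒< (toℕ v) (toℕ u) (subst T (sym v<u) tt)))
    ... | true  | false = sym (+-identityʳ _)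
    ... | false | true  = cong ⟦_⟧ (edges-sym H u v)
    ... | false | false = cong ⟦_⟧ (subst (λ w → edges H u w ≡ false) u≡v (edges-irr H u))
      where
      ≮ : ∀ a b → (a <ᵇ b) ≡ false → b ≤ a
      ≮ a b eq = ≮⇒≥ (λ lt → subst T eq (<⇒<ᵇ lt))
      u≡v = toℕ-injective (≤-antisym (≮ (toℕ v) (toℕ u) v<u) (≮ (toℕ u) (toℕ v) u<v))

  induced : ∀ {n} (G : Graph n) → (Fin n → Bool) → Subgraph G
  induced G S = record
    { verts     = S
    ; edges     = λ u v → S u ∧ (S v ∧ adj G u v)
    ; edges-sym = λ u v → trans (cong (λ a → S u ∧ (S v ∧ a)) (adj-sym G u v)) (∧-swap (S u) (S v) _)
    ; edges-⊆   = λ u v uv → let (S-u , S-v∧uv) = Equivalence.to T-∧ uv ; (S-v , uv′) = Equivalence.to T-∧ S-v∧uv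
                             in uv′ , S-u , S-v
    }
    where
    ∧-swap : ∀ a b c → a ∧ (b ∧ c) ≡ b ∧ (a ∧ c)
    ∧-swap true  b c = refl
    ∧-swap false b c = sym (∧-zeroʳ b)

  module Density {n : ℕ} (G : Graph n) (d : ℕ) (S : Fin n → Bool) where

    open Layer G d S

    -- Stated with edges (induced G S) v and low v unfolded, so that `with S v` can rewrite them.
    degree-bound : ∀ v → d * ⟦ S v ⟧ ≤ count (λ w → S v ∧ (S w ∧ adj G v w)) + d * ⟦ S v ∧ (degIn v <ᵇ d) ⟧
    degree-bound v with S v
    ... | false = ≤-trans (≤-reflexive (*-zeroʳ d)) z≤n
    ... | true with degIn v <ᵇ d in low-v
    ...   | true  = m≤n+m (d * 1) _
    ...   | false = ≤-trans (≤-reflexive (*-identityʳ d)) (≤-trans (≮⇒≥ (λ lt → subst T low-v (<⇒<ᵇ lt))) (m≤m+n _ _))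

    degree-sum : d * count S ≤ (|E| (induced G S) + |E| (induced G S)) + d * count low
    degree-sum = begin
      d * count S
        ≡⟨ cong (d *_) (count≡∑ S) ⟩
      d * ∑[ v < n ] ⟦ S v ⟧
        ≡⟨ *-distribˡ-sum d (λ v → ⟦ S v ⟧) ⟩
      ∑[ v < n ] (d * ⟦ S v ⟧)
        ≤⟨ ∑-mono-≤ degree-bound ⟩
      ∑[ v < n ] (count (edges H v) + d * ⟦ low v ⟧)
        ≡⟨ ∑-distrib-+ (λ v → count (edges H v)) (λ v → d * ⟦ low v ⟧) ⟩
      ∑[ v < n ] count (edges H v) + ∑[ v < n ] (d * ⟦ low v ⟧)
        ≡⟨ cong₂ _+_ (handshake H) (trans (sym (*-distribˡ-sum d (λ v → ⟦ low v ⟧))) (cong (d *_) (sym (count≡∑ low)))) ⟩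
      (|E| H + |E| H) + d * count low ∎
      where
      open ≤-Reasoning
      H = induced G S

  -- Moving ε to the left keeps every numerator non-negative; the two sides are then compared
  -- by cross-multiplication in ℚᵘ.
  clear-denominators : ∀ a m d p q .{{_ : NonZero m}} .{c : Coprime (suc p) (suc q)} →
                       (ℤ.+ a / m) ℚ.≤ (ℤ.+ d / 1) ℚ.- mkℚ (ℤ.+ suc p) q c →
                       a * suc q + suc p * m ≤ d * (m * suc q)
  clear-denominators a m@(suc m₀) d p q {c = c} le = ℤP.drop‿+≤+ (begin
    ℤ.+ (a * suc q + suc p * m)
      ≡⟨ trans (ℤP.pos-+ (a * suc q) _) (cong₂ ℤ._+_ (ℤP.pos-* a (suc q)) (ℤP.pos-* (suc p) m)) ⟩
    ℤ.+ a ℤ.* ℤ.+ suc q ℤ.+ ℤ.+ suc p ℤ.* ℤ.+ m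
      ≡⟨ ℤP.*-identityʳ _ ⟨
    (ℤ.+ a ℤ.* ℤ.+ suc q ℤ.+ ℤ.+ suc p ℤ.* ℤ.+ m) ℤ.* ℤ.+ 1
      ≤⟨ ℚᵘP.drop-*≤* X+E≤D ⟩
    ℤ.+ d ℤ.* ℤ.+ (m * suc q)
      ≡⟨ ℤP.pos-* d _ ⟨
    ℤ.+ (d * (m * suc q)) ∎)
    where
    open ℤP.≤-Reasoning
    X = mkℚᵘ (ℤ.+ a) m₀
    E = mkℚᵘ (ℤ.+ suc p) q
    D = mkℚᵘ (ℤ.+ d) 0
    ε = mkℚ (ℤ.+ suc p) q c
    x+ε≤d : (ℤ.+ a / m) ℚ.+ ε ℚ.≤ ℤ.+ d / 1
    x+ε≤d = subst ((ℤ.+ a / m) ℚ.+ ε ℚ.≤_)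
                  (trans (ℚP.+-assoc (ℤ.+ d / 1) (ℚ.- ε) ε)
                         (trans (cong ((ℤ.+ d / 1) ℚ.+_) (ℚP.+-inverseˡ ε)) (ℚP.+-identityʳ (ℤ.+ d / 1))))
                  (ℚP.+-monoˡ-≤ ε le)
    X+E≤D : X ℚᵘ.+ E ℚᵘ.≤ D
    X+E≤D = ℚᵘP.≤-respʳ-≃ (ℚP.toℚᵘ-fromℚᵘ D)
              (ℚᵘP.≤-respˡ-≃ (ℚᵘP.≃-trans (ℚP.toℚᵘ-homo-+ (ℤ.+ a / m) ε) (ℚᵘP.+-congˡ E (ℚP.toℚᵘ-fromℚᵘ X)))
                (ℚP.toℚᵘ-mono-≤ x+ε≤d))

  -- 2|E(G[S])|/|S| ≤ d − (p + 1)/(q + 1) with the denominators cleared; note that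
  -- mkℚ (+ (p + 1)) q stands for (p + 1)/(q + 1).
  Sparse : ∀ {n} → Graph n → ℕ → ℕ → ℕ → Set
  Sparse {n} G d p q = ∀ (S : Fin n → Bool) → 0 < count S →
                       2 * |E| (induced G S) * suc q + suc p * count S ≤ d * (count S * suc q)

  mad⇒sparse : ∀ {n} (G : Graph n) d p q .{c : Coprime (suc p) (suc q)} →
               MadEq G ((ℤ.+ d / 1) ℚ.- mkℚ (ℤ.+ suc p) q c) → Sparse G d p q
  mad⇒sparse G d p q (avg≤ , _) S nonempty =
    clear-denominators (2 * |E| (induced G S)) (count S) d p q {{>-nonZero nonempty}} (avg≤ (induced G S) nonempty)

  sparse⇒peelable : ∀ {n} (G : Graph n) d p q → Sparse G d p q → Peelable G d (suc q * d)
  sparse⇒peelable G d p q sparse S with count S in |S|≡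
  ... | zero  = z≤n
  ... | suc m = +-cancelˡ-≤ (2|E| * Q) (suc m) (Q * d * count low) (begin
    2|E| * Q + suc m
      ≤⟨ +-monoʳ-≤ (2|E| * Q) (m≤n*m (suc m) (suc p)) ⟩
    2|E| * Q + suc p * suc m
      ≤⟨ subst (λ s → 2|E| * Q + suc p * s ≤ d * (s * Q)) |S|≡ (sparse S (subst (0 <_) (sym |S|≡) z<s)) ⟩
    d * (suc m * Q)
      ≡⟨ solve 3 (λ d m Q → d :* (m :* Q) := Q :* (d :* m)) refl d (suc m) Q ⟩
    Q * (d * suc m)
      ≤⟨ *-monoʳ-≤ Q (subst (λ s → d * s ≤ (|E| H + |E| H) + d * count low) |S|≡ degree-sum) ⟩
    Q * ((|E| H + |E| H) + d * count low)
      ≡⟨ solve 4 (λ Q E d l → Q :* ((E :+ E) :+ d :* l) := (con 2 :* E) :* Q :+ Q :* d :* l) refl Q (|E| H) d (count low) ⟩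
    2|E| * Q + Q * d * count low ∎)
    where
    open Layer G d S
    open Density G d S
    open ≤-Reasoning
    open +-*-Solver using (solve; _:+_; _:*_; _:=_; con)
    H = induced G S
    Q = suc q
    2|E| = 2 * |E| H

open import Defs
open import Data.Nat using (ℕ; _≤_; _+_; _*_; _^_)
open import Data.Fin using (Fin)
open import Data.Integer using (+_)
open import Data.Rational using (ℚ; 0ℚ; _<_; _-_; _/_)
open import Data.Product using (_×_; ∃-syntax)

open import Data.Nat using (suc; NonZero; >-nonZero)
open import Data.Nat.Properties using (+-comm; m*n≢0)
open import Data.Integer using (-[1+_]; +<+)
open import Data.Rational using (mkℚ; *<*)
open import Data.Product using (_,_)
open import Relation.Binary.PropositionalEquality using (subst)
open Reconfiguration using (mad⇒sparse; sparse⇒peelable; module Recolouring)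

theorem1 : ∀ (d : ℕ) (ε : ℚ) → 1 ≤ d → 0ℚ < ε →
    ∃[ c ] (∀ (k : ℕ) → d + 1 ≤ k →
      ∃[ C ] (1 ≤ C × (∀ (n : ℕ) (G : Graph n) → MadEq G ((+ d / 1) - ε) →
        ∀ (f g : Fin n → Fin k) → Proper G k f → Proper G k g →
          Reach G k (C * n ^ c) f g)))
theorem1 d (mkℚ (+ 0) _ _)       _   (*<* (+<+ ()))
theorem1 d (mkℚ -[1+ _ ] _ _)    _   (*<* ())
theorem1 d (mkℚ (+ suc p) q _)   1≤d _ = suc (N * (d + 1)) , λ k d+1≤k →
  d , 1≤d , λ n G mad f g proper-f proper-g →
    Recolouring.recolouring G {{m*n≢0 (suc q) d}} (subst (_≤ k) (+-comm d 1) d+1≤k) 1≤d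
      (sparse⇒peelable G d p q (mad⇒sparse G d p q mad)) proper-f proper-g
  where
  N = suc q * d
  instance
    d≢0 : NonZero d
    d≢0 = >-nonZero 1≤d
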